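{- There is a bijection $\Phi:\mathcal{G}\to\mathcal{M}$ such that, for every $G\in\mathcal{G}$, the bubbles of $G$ correspond to the square-vertices of $\Phi(G)$, the faces of color 1 (resp. color 2) of $G$ correspond to the faces of the map $\Phi(G)^{(1)}$ (resp. $\Phi(G)^{(2)}$), and the faces of color 3 of $G$ correspond to the black vertices of $\Phi(G)$. In particular $G$ and $\Phi(G)$ have the same number of bubbles/square-vertices and $F(G)=F(\Phi(G))$.
   Context: Colored graphs: a colored graph is a finite bipartite graph (black and white vertices), 4-regular, whose edges carry colors in $\{0,1,2,3\}$ so that each vertex is incident to exactly one edge of each color. Let $B$ be the colored graph (without color 0) on white vertices $1_\circ,2_\circ,3_\circ,4_\circ$ and black vertices $1_\bullet,\dots,4_\bullet$ whose edges are: color 3: $i_\circ i_\bullet$ for $i=1,\dots,4$; color 1: $1_\circ 2_\bullet, 2_\circ 1_\bullet, 3_\circ 4_\bullet, 4_\circ 3_\bullet$; color 2: $1_\circ 4_\bullet, 4_\circ 1_\bullet, 2_\circ 3_\bullet, 3_\circ 2_\bullet$ (this is the graph dual to an octahedron made of eight colored tetrahedra). A bubble of a colored graph is a maximal connected subgraph using only colors 1, 2, 3. $\mathcal{G}$ is the set of connected colored graphs all of whose bubbles are isomorphic (as edge-colored bipartite graphs) to $B$, considered up to color-preserving isomorphism; equivalently, connected graphs obtained from finitely many copies of $B$ by adding color-0 edges forming a perfect matching between white and black vertices. For $a\in\{1,2,3\}$, a face of color $a$ of $G$ is a cycle of $G$ whose edges alternate between colors 0 and $a$; $F(G)$ is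 the total number of faces of colors 1, 2, 3. The set $\mathcal{M}$: an element $M\in\mathcal{M}$ is a connected graph made of (i) square-vertices: cycles of length four whose edges ("inner edges") are colored alternately $1,2,1,2$ and whose vertices are called inner vertices; (ii) black vertices of arbitrary finite degree, each equipped with a cyclic ordering of its incident edges; (iii) edges (distinct from inner edges), each joining a black vertex to an inner vertex, such that every inner vertex is incident to exactly one such edge. Elements are taken up to isomorphisms preserving colors and cyclic orders. For $c\in\{1,2\}$, $M^{(c)}$ is the combinatorial map obtained from $M$ by deleting all inner edges of the color other than $c$, then erasing each (now bivalent) inner vertex and merging its edge with its inner edge; its vertices are the black vertices of $M$ with the induced cyclic orders (if $M$ has $b$ square-vertices, $M^{(c)}$ has $2b$ edges). Faces of $M^{(c)}$ are the usual faces of a combinatorial map (an isolated vertex has one face). The faces of $M$ are the faces of $M^{(1)}$, the faces of $M^{(2)}$ and the black vertices of $M$; $F(M)$ denotes their total number. -}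

module Defs where

open import Data.Nat using (ℕ; zero; suc; _+_; _*_; _≤_)
open import Data.Nat.Properties using (_≤?_)
open import Data.Fin using (Fin; zero; suc; toℕ; combine; remQuot)
open import Data.Fin.Permutation using (Permutation; Permutation′; _⟨$⟩ʳ_)
open import Data.List using (List; upTo; allFin; map)
open import Data.Nat.ListAction using (sum)
open import Data.Bool.ListAction using (all)
open import Data.Bool using (Bool; true; false; if_then_else_)
open import Data.Product using (Σ; _×_; _,_; proj₁; proj₂)
open import Data.Sum using (_⊎_; inj₁; inj₂)
open import Relation.Nullary.Decidable using (⌊_⌋)
open import Relation.Binary.PropositionalEquality using (_≡_)
open import Relation.Binary.Bundles using (Setoid)
open import Relation.Binary.Construct.Closure.Equivalence using (EqClosure)
import Relation.Binary.Construct.Closure.Equivalence as EqC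
open import Level using (0ℓ)

-- For a permutation f these equivalence classes are exactly its cycles.
Orbits : ∀ {m} → (Fin m → Fin m) → Setoid 0ℓ 0ℓ
Orbits {m} f = EqC.setoid {A = Fin m} (λ i j → j ≡ f i)

iter : ∀ {m} → (Fin m → Fin m) → ℕ → Fin m → Fin m
iter f zero    i = i
iter f (suc k) i = f (iter f k i)

-- number of cycles of a permutation f of Fin m: number of i that are the
-- least element (w.r.t. toℕ) of their orbit {f^k i | k < m}.
numCycles : ∀ {m} → (Fin m → Fin m) → ℕ
numCycles {m} f =
  sum (map (λ i → if all (λ k → ⌊ toℕ i ≤? toℕ (iter f k i) ⌋) (upTo m)
                  then 1 else 0)
           (allFin m))

block : ∀ {n} → Fin (n * 4) → Fin n
block {n} i = proj₁ (remQuot {n} 4 i)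

pos : ∀ {n} → Fin (n * 4) → Fin 4
pos {n} i = proj₂ (remQuot {n} 4 i)

inBlock : ∀ {n} → (Fin 4 → Fin 4) → Fin (n * 4) → Fin (n * 4)
inBlock {n} s i = combine (block {n} i) (s (pos {n} i))

-- positions 0,1,2,3 stand for the vertices 1,2,3,4 (of B, resp. of a square)
-- s₁ : 0↔1, 2↔3      s₂ : 0↔3, 1↔2
s₁ : Fin 4 → Fin 4
s₁ zero                   = suc zero
s₁ (suc zero)             = zero
s₁ (suc (suc zero))       = suc (suc (suc zero))
s₁ (suc (suc (suc zero))) = suc (suc zero)

s₂ : Fin 4 → Fin 4
s₂ zero                   = suc (suc (suc zero))
s₂ (suc zero)             = suc (suc zero)
s₂ (suc (suc zero))       = suc zero
s₂ (suc (suc (suc zero))) = zero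

-- A graph with n ≥ 1 copies of B.  White vertex i of copy k and black vertex
-- i of copy k are both indexed by  combine k i : Fin (n * 4).
-- Inside each copy of B (vertex j ∈ {1..4} ↦ position j-1):
--   color 3 joins white x to black x,
--   color 1 joins white x to black (inBlock s₁ x)  (1∘2•, 2∘1•, 3∘4•, 4∘3•),
--   color 2 joins white x to black (inBlock s₂ x)  (1∘4•, 4∘1•, 2∘3•, 3∘2•).
-- The color-0 perfect matching is a permutation σ: white x — black (σ x).

data Color : Set where
  c1 c2 c3 : Color

-- black endpoint (index) of the color-a edge at white x
τ : ∀ {n} → Color → Fin (n * 4) → Fin (n * 4)
τ {n} c1 x = inBlock {n} s₁ x
τ {n} c2 x = inBlock {n} s₂ x
τ {n} c3 x = x

-- vertices of the graph: inj₁ = white, inj₂ = black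
GVertex : ℕ → Set
GVertex n = Fin (n * 4) ⊎ Fin (n * 4)

data GAdj {n : ℕ} (σ : Permutation′ (n * 4)) : GVertex n → GVertex n → Set where
  edge0 : ∀ x → GAdj σ (inj₁ x) (inj₂ (σ ⟨$⟩ʳ x))
  edgeC : ∀ a x → GAdj σ (inj₁ x) (inj₂ (τ {n} a x))

record GGraph : Set where
  field
    n        : ℕ
    nonempty : 1 ≤ n
    σ        : Permutation′ (n * 4)
    connected : ∀ u v → EqClosure {A = GVertex n} (GAdj {n} σ) u v

open GGraph public

-- Since color-3 edges join
-- white x to black x on both sides, an isomorphism is given by one bijection f
-- (acting identically on white and black indices) preserving colors 0,1,2,3.
record _≅G_ (G G′ : GGraph) : Set where
  field
    f     : Permutation (n G * 4) (n G′ * 4)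
    pres0 : ∀ x → f ⟨$⟩ʳ (σ G ⟨$⟩ʳ x) ≡ σ G′ ⟨$⟩ʳ (f ⟨$⟩ʳ x)
    pres1 : ∀ x → f ⟨$⟩ʳ (τ {n G} c1 x) ≡ τ {n G′} c1 (f ⟨$⟩ʳ x)
    pres2 : ∀ x → f ⟨$⟩ʳ (τ {n G} c2 x) ≡ τ {n G′} c2 (f ⟨$⟩ʳ x)

-- bubbles of G: the copies of B (connected, and maximal since they are closed
-- under colors 1,2,3)
Bubbles : GGraph → Set
Bubbles G = Fin (n G)

-- faces of color a: a face alternating colors 0 and a is traversed as
-- white x → (color 0) black σ x → (color a) white τ_a (σ x)   (τ_a involutive)
faceStep : (G : GGraph) → Color → Fin (n G * 4) → Fin (n G * 4)
faceStep G a x = τ {n G} a (σ G ⟨$⟩ʳ x)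

FacesG : (G : GGraph) → Color → Setoid 0ℓ 0ℓ
FacesG G a = Orbits (faceStep G a)

FG : GGraph → ℕ
FG G = numCycles (faceStep G c1) + numCycles (faceStep G c2)
     + numCycles (faceStep G c3)

-- The class ℳ.
-- b ≥ 1 square-vertices; inner vertex at position p ∈ Fin 4 of square k is
-- combine k p : Fin (b * 4).  Inner edges of square k (cycle v0 v1 v2 v3):
--   color 1: v0v1, v2v3   (i ↦ inBlock s₁ i),
--   color 2: v1v2, v3v0   (i ↦ inBlock s₂ i).
-- Each inner vertex carries exactly one edge to a black vertex, so the
-- (non-inner) edges are indexed by the inner vertices as well.  The black
-- vertices with their cyclic orders are encoded by a permutation ρ of the
-- edges: its cycles are the black vertices, and ρ e is the successor of e in
-- the cyclic order around its black vertex (standard combinatorial-map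
-- encoding; every black vertex has degree ≥ 1 by connectedness, b ≥ 1).

ι : ∀ {b} → Color → Fin (b * 4) → Fin (b * 4)
ι {b} c1 i = inBlock {b} s₁ i
ι {b} c2 i = inBlock {b} s₂ i
ι {b} c3 i = i   -- unused

data MAdj {b : ℕ} (ρ : Permutation′ (b * 4)) : Fin (b * 4) → Fin (b * 4) → Set where
  inner1 : ∀ i → MAdj ρ i (inBlock {b} s₁ i)
  inner2 : ∀ i → MAdj ρ i (inBlock {b} s₂ i)
  atBlack : ∀ i → MAdj ρ i (ρ ⟨$⟩ʳ i)

record MMap : Set where
  field
    b        : ℕ
    nonempty : 1 ≤ b
    ρ        : Permutation′ (b * 4)
    connected : ∀ i j → EqClosure {A = Fin (b * 4)} (MAdj {b} ρ) i j

open MMap public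

record _≅M_ (M M′ : MMap) : Set where
  field
    f       : Permutation (b M * 4) (b M′ * 4)
    presρ   : ∀ i → f ⟨$⟩ʳ (ρ M ⟨$⟩ʳ i) ≡ ρ M′ ⟨$⟩ʳ (f ⟨$⟩ʳ i)
    pres1   : ∀ i → f ⟨$⟩ʳ (inBlock {b M} s₁ i) ≡ inBlock {b M′} s₁ (f ⟨$⟩ʳ i)
    pres2   : ∀ i → f ⟨$⟩ʳ (inBlock {b M} s₂ i) ≡ inBlock {b M′} s₂ (f ⟨$⟩ʳ i)

SquareVertices : MMap → Set
SquareVertices M = Fin (b M)

BlackVertices : MMap → Setoid 0ℓ 0ℓ
BlackVertices M = Orbits (ρ M ⟨$⟩ʳ_)

-- the map M^(c), c ∈ {1,2}: half-edges = inner vertices, edge involution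
-- ι_c, vertex rotation ρ; its faces are the cycles of ρ ∘ ι_c.
mapFaceStep : (M : MMap) → Color → Fin (b M * 4) → Fin (b M * 4)
mapFaceStep M c i = ρ M ⟨$⟩ʳ (ι {b M} c i)

FacesMap : (M : MMap) → Color → Setoid 0ℓ 0ℓ
FacesMap M c = Orbits (mapFaceStep M c)

FM : MMap → ℕ
FM M = numCycles (mapFaceStep M c1) + numCycles (mapFaceStep M c2)
     + numCycles (ρ M ⟨$⟩ʳ_)

-- Both classes are encoded by the same data: n copies of a 4-element block on
-- which the involutions s₁, s₂ act, plus a permutation of the 4n indices (the
-- colour-0 matching σ of G, resp. the rotation ρ of M).  So Φ keeps the data,
-- transports connectivity by contracting the colour-3 edges, and preserves and
-- reflects isomorphisms on the nose.  The faces of colour a are the cycles of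
-- sₐ ∘ σ, those of M^(a) the cycles of σ ∘ sₐ, and the colour-3 faces the
-- cycles of σ.  As π ∘ τ and τ ∘ π are conjugate (by π), their orbits
-- correspond; equality of the cycle counts also needs that counting the
-- minima of the orbits does not depend on the order used to pick them.
module Submission where

open import Defs
open import Data.Bool using (Bool; true; false; if_then_else_; T)
open import Data.Bool.Properties using (T-irrelevant)
open import Data.Fin using (Fin; zero; suc; toℕ; combine)
import Data.Fin.Properties as Finₚ
open import Data.Fin.Permutation as Perm
  using (Permutation′; _⟨$⟩ʳ_; _⟨$⟩ˡ_; inverseˡ; inverseʳ; _∘ₚ_; ↔⇒≡)
open import Data.List using (tabulate; applyUpTo; upTo)
import Data.List.Properties as Listₚ
open import Data.List.Extrema.Nat using (argmin; argmin-sel; f[argmin]≤f[xs])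
open import Data.List.Membership.Propositional.Properties using (∈-applyUpTo⁻)
open import Data.List.Relation.Unary.All.Properties using (all⁺; all⁻; applyUpTo⁻; applyUpTo⁺₁)
open import Data.Nat using (ℕ; zero; suc; _+_; _*_; _≤_; _<_; _≤?_; s≤s; s≤s⁻¹)
open import Data.Nat.DivMod using (_%_; _/_; m≡m%n+[m/n]*n; m%n<n)
open import Data.Nat.ListAction using (sum)
open import Data.Nat.Properties
open import Data.Bool.ListAction using (all; and)
open import Data.Product using (Σ; ∃; _×_; _,_)
open import Data.Product.Properties using (Σ-≡,≡→≡)
open import Data.Sum using (inj₁; inj₂)
open import Data.Sum.Function.Propositional using (_⊎-↔_)
open import Data.Unit using (tt)
open import Function using (_∘_; id)
open import Function.Bundles using (Bijection; _⤖_; _↔_; mk↔ₛ′)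
open import Function.Construct.Composition using (_↔-∘_)
open import Function.Construct.Identity using (⤖-id; bijection)
open import Function.Construct.Symmetry using (↔-sym)
open import Function.Definitions using (Injective)
open import Relation.Binary.PropositionalEquality
open import Relation.Binary.Construct.Closure.Equivalence using (EqClosure)
import Relation.Binary.Construct.Closure.Equivalence as EqClosure
open import Relation.Binary.Construct.Closure.ReflexiveTransitive using (ε; _◅◅_)
open import Relation.Nullary.Decidable using (⌊_⌋; toWitness; fromWitness)

private
  variable
    m : ℕ

count : (Fin m → Bool) → ℕ
count P = sum (tabulate (λ i → if P i then 1 else 0))

Fin-if↔T : ∀ b → Fin (if b then 1 else 0) ↔ T b
Fin-if↔T true  = mk↔ₛ′ (λ _ → tt) (λ _ → zero) (λ _ → refl) (λ { zero → refl })
Fin-if↔T false = mk↔ₛ′ (λ ()) (λ ()) (λ ()) (λ ())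

count↔Σ : (P : Fin m → Bool) → Fin (count P) ↔ Σ (Fin m) (T ∘ P)
count↔Σ {zero}  P = mk↔ₛ′ (λ ()) (λ ()) (λ ()) (λ ())
count↔Σ {suc m} P = split ↔-∘ ((Fin-if↔T (P zero) ⊎-↔ count↔Σ (P ∘ suc)) ↔-∘ Finₚ.+↔⊎)
  where
  split = mk↔ₛ′ (λ { (inj₁ p) → zero , p ; (inj₂ (i , p)) → suc i , p })
                (λ { (zero , p) → inj₁ p ; (suc i , p) → inj₂ (i , p) })
                (λ { (zero , _) → refl ; (suc _ , _) → refl })
                (λ { (inj₁ _) → refl ; (inj₂ _) → refl })

count-cong-↔ : {n : ℕ} (P : Fin m → Bool) (Q : Fin n → Bool) →
               Σ (Fin m) (T ∘ P) ↔ Σ (Fin n) (T ∘ Q) → count P ≡ count Q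
count-cong-↔ P Q e = ↔⇒≡ (↔-sym (count↔Σ Q) ↔-∘ (e ↔-∘ count↔Σ P))

count-cong : (P Q : Fin m → Bool) (u v : Fin m → Fin m) →
             (∀ i → T (P i) → T (Q (u i))) → (∀ j → T (Q j) → T (P (v j))) →
             (∀ i → T (P i) → v (u i) ≡ i) → (∀ j → T (Q j) → u (v j) ≡ j) →
             count P ≡ count Q
count-cong P Q u v uQ vP vu uv = count-cong-↔ P Q (mk↔ₛ′
  (λ (i , p) → u i , uQ i p) (λ (j , q) → v j , vP j q)
  (λ (j , q) → Σ-≡,≡→≡ (uv j q , T-irrelevant _ _))
  (λ (i , p) → Σ-≡,≡→≡ (vu i p , T-irrelevant _ _)))

count-≗ : {P Q : Fin m → Bool} → (∀ i → P i ≡ Q i) → count P ≡ count Q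
count-≗ P≗Q = cong sum (Listₚ.tabulate-cong (λ i → cong (λ b → if b then 1 else 0) (P≗Q i)))

count-∘-permute : (P : Fin m → Bool) (g : Permutation′ m) → count (P ∘ (g ⟨$⟩ʳ_)) ≡ count P
count-∘-permute P g = count-cong _ _ (g ⟨$⟩ʳ_) (g ⟨$⟩ˡ_)
  (λ _ p → p) (λ _ p → subst (T ∘ P) (sym (inverseʳ g)) p)
  (λ _ _ → inverseˡ g) (λ _ _ → inverseʳ g)

iter-+ : (f : Fin m → Fin m) → ∀ a b i → iter f (a + b) i ≡ iter f a (iter f b i)
iter-+ f zero    b i = refl
iter-+ f (suc a) b i = cong f (iter-+ f a b i)

iter-* : (f : Fin m → Fin m) {p : ℕ} {i : Fin m} → iter f p i ≡ i → ∀ q → iter f (q * p) i ≡ i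
iter-* f         e zero    = refl
iter-* f {p} {i} e (suc q) = begin
  iter f (p + q * p) i       ≡⟨ iter-+ f p (q * p) i ⟩
  iter f p (iter f (q * p) i) ≡⟨ cong (iter f p) (iter-* f e q) ⟩
  iter f p i                 ≡⟨ e ⟩
  i                          ∎
  where open ≡-Reasoning

iter-conj : (f f′ g : Fin m → Fin m) → (∀ x → f′ (g x) ≡ g (f x)) →
            ∀ k x → iter f′ k (g x) ≡ g (iter f k x)
iter-conj f f′ g comm zero    x = refl
iter-conj f f′ g comm (suc k) x = trans (cong f′ (iter-conj f f′ g comm k x)) (comm _)

-- The orbit of i is {f^k i | k < m} (see Orbit.↝-bounded).
orbitMin? : (Fin m → Fin m) → (Fin m → ℕ) → Fin m → Bool
orbitMin? {m} f h i = all (λ k → ⌊ h i ≤? h (iter f k i) ⌋) (upTo m)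

numCycles≡count : (f : Fin m → Fin m) → numCycles f ≡ count (orbitMin? f toℕ)
numCycles≡count f = cong sum (Listₚ.map-tabulate id (λ i → if orbitMin? f toℕ i then 1 else 0))

module Orbit (π : Permutation′ m) where

  private
    f : Fin m → Fin m
    f = π ⟨$⟩ʳ_

  iter-injective : ∀ k → Injective _≡_ _≡_ (iter f k)
  iter-injective zero    eq = eq
  iter-injective (suc k) eq =
    iter-injective k (trans (sym (inverseˡ π)) (trans (cong (π ⟨$⟩ˡ_) eq) (inverseˡ π)))

  -- pigeonhole on i, f i, …, f^m i, then cancel the common prefix
  period : ∀ i → ∃ λ p → suc p ≤ m × iter f (suc p) i ≡ i
  period i with a , b , a<b , eq ← Finₚ.pigeonhole (n<1+n m) (λ j → iter f (toℕ j) i)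
               with p , a+p≡b ← m≤n⇒∃[o]m+o≡n a<b = p , p<m , iter-injective (toℕ a) (begin
    iter f (toℕ a) (iter f (suc p) i) ≡⟨ iter-+ f (toℕ a) (suc p) i ⟨
    iter f (toℕ a + suc p) i          ≡⟨ cong (λ k → iter f k i) (trans (+-suc (toℕ a) p) a+p≡b) ⟩
    iter f (toℕ b) i                  ≡⟨ eq ⟨
    iter f (toℕ a) i                  ∎)
    where
    open ≡-Reasoning
    p<m : suc p ≤ m
    p<m = ≤-trans (s≤s (m≤n+m p (toℕ a))) (≤-trans (≤-reflexive a+p≡b) (s≤s⁻¹ (Finₚ.toℕ<n b)))

  _↝_ : Fin m → Fin m → Set
  i ↝ j = ∃ λ k → iter f k i ≡ j

  ↝-refl : ∀ {i} → i ↝ i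
  ↝-refl = 0 , refl

  ↝-trans : ∀ {i j l} → i ↝ j → j ↝ l → i ↝ l
  ↝-trans {i} (a , refl) (b , refl) = b + a , iter-+ f b a i

  ↝-sym : ∀ {i j} → i ↝ j → j ↝ i
  ↝-sym {i} (k , refl) with p , _ , e ← period i = k * p , (begin
    iter f (k * p) (iter f k i) ≡⟨ iter-+ f (k * p) k i ⟨
    iter f (k * p + k) i        ≡⟨ cong (λ l → iter f l i) (trans (+-comm (k * p) k) (sym (*-suc k p))) ⟩
    iter f (k * suc p) i        ≡⟨ iter-* f e k ⟩
    i                           ∎)
    where open ≡-Reasoning

  ↝-bounded : ∀ {i j} → i ↝ j → ∃ λ k → k < m × iter f k i ≡ j
  ↝-bounded {i} (k , refl) with p , p<m , e ← period i =
    k % suc p , <-≤-trans (m%n<n k (suc p)) p<m , (begin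
      iter f (k % suc p) i                             ≡⟨ cong (iter f (k % suc p)) (iter-* f e (k / suc p)) ⟨
      iter f (k % suc p) (iter f (k / suc p * suc p) i) ≡⟨ iter-+ f (k % suc p) (k / suc p * suc p) i ⟨
      iter f (k % suc p + k / suc p * suc p) i          ≡⟨ cong (λ l → iter f l i) (m≡m%n+[m/n]*n k (suc p)) ⟨
      iter f k i                                       ∎)
    where open ≡-Reasoning

  module _ (h : Fin m → ℕ) where

    orbitMin?-sound : ∀ {i} → T (orbitMin? f h i) → ∀ {j} → i ↝ j → h i ≤ h j
    orbitMin?-sound t r with k , k<m , refl ← ↝-bounded r =
      toWitness (applyUpTo⁻ id m (all⁺ _ (upTo m) t) k<m)

    orbitMin?-complete : ∀ {i} → (∀ {j} → i ↝ j → h i ≤ h j) → T (orbitMin? f h i)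
    orbitMin?-complete minimal = all⁻ _ (applyUpTo⁺₁ id m (λ {k} _ → fromWitness (minimal (k , refl))))

    orbitMinimum : Fin m → Fin m
    orbitMinimum i = argmin h i (applyUpTo (λ k → iter f k i) m)

    ↝-orbitMinimum : ∀ i → i ↝ orbitMinimum i
    ↝-orbitMinimum i with argmin-sel h i (applyUpTo (λ k → iter f k i) m)
    ... | inj₁ eq = 0 , sym eq
    ... | inj₂ ∈orbit with k , _ , eq ← ∈-applyUpTo⁻ (λ k → iter f k i) ∈orbit = k , sym eq

    orbitMinimum-≤ : ∀ i {j} → i ↝ j → h (orbitMinimum i) ≤ h j
    orbitMinimum-≤ i r with k , k<m , refl ← ↝-bounded r =
      applyUpTo⁻ (λ k → iter f k i) m (f[argmin]≤f[xs] {f = h} i (applyUpTo (λ k → iter f k i) m)) k<m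

    orbitMin?-orbitMinimum : ∀ i → T (orbitMin? f h (orbitMinimum i))
    orbitMin?-orbitMinimum i =
      orbitMin?-complete (λ r → orbitMinimum-≤ i (↝-trans (↝-orbitMinimum i) r))

    module _ (h-injective : Injective _≡_ _≡_ h) where

      orbitMinimum-cong : ∀ {i j} → i ↝ j → orbitMinimum i ≡ orbitMinimum j
      orbitMinimum-cong {i} {j} r = h-injective (≤-antisym
        (orbitMinimum-≤ i (↝-trans r (↝-orbitMinimum j)))
        (orbitMinimum-≤ j (↝-trans (↝-sym r) (↝-orbitMinimum i))))

      orbitMinimum-fixed : ∀ {i} → T (orbitMin? f h i) → orbitMinimum i ≡ i
      orbitMinimum-fixed {i} t = h-injective (≤-antisym
        (orbitMinimum-≤ i ↝-refl) (orbitMin?-sound t (↝-orbitMinimum i)))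

  -- Both counts are the number of orbits: x ↦ (h₂-minimum of its orbit) and
  -- back are mutually inverse between the two sets of representatives.
  count-orbitMin?-invariant : {h₁ h₂ : Fin m → ℕ} →
    Injective _≡_ _≡_ h₁ → Injective _≡_ _≡_ h₂ →
    count (orbitMin? f h₁) ≡ count (orbitMin? f h₂)
  count-orbitMin?-invariant {h₁} {h₂} h₁-inj h₂-inj =
    count-cong _ _ (orbitMinimum h₂) (orbitMinimum h₁)
      (λ i _ → orbitMin?-orbitMinimum h₂ i) (λ j _ → orbitMin?-orbitMinimum h₁ j)
      (λ i t → trans (sym (orbitMinimum-cong h₁ h₁-inj (↝-orbitMinimum h₂ i))) (orbitMinimum-fixed h₁ h₁-inj t))
      (λ j t → trans (sym (orbitMinimum-cong h₂ h₂-inj (↝-orbitMinimum h₁ j))) (orbitMinimum-fixed h₂ h₂-inj t))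

-- Transporting along g, an f′-orbit minimum for toℕ is an f-orbit minimum
-- for toℕ ∘ g, and the latter count does not depend on the key.
numCycles-conj : (π g : Permutation′ m) (f′ : Fin m → Fin m) →
                 (∀ x → f′ (g ⟨$⟩ʳ x) ≡ g ⟨$⟩ʳ (π ⟨$⟩ʳ x)) →
                 numCycles f′ ≡ numCycles (π ⟨$⟩ʳ_)
numCycles-conj {m} π g f′ comm = begin
  numCycles f′                                          ≡⟨ numCycles≡count f′ ⟩
  count (orbitMin? f′ toℕ)                               ≡⟨ count-∘-permute _ g ⟨
  count (orbitMin? f′ toℕ ∘ (g ⟨$⟩ʳ_))                   ≡⟨ count-≗ transport ⟩
  count (orbitMin? (π ⟨$⟩ʳ_) (toℕ ∘ (g ⟨$⟩ʳ_)))          ≡⟨ Orbit.count-orbitMin?-invariant π toℕ∘g-injective Finₚ.toℕ-injective ⟩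
  count (orbitMin? (π ⟨$⟩ʳ_) toℕ)                        ≡⟨ numCycles≡count (π ⟨$⟩ʳ_) ⟨
  numCycles (π ⟨$⟩ʳ_)                                   ∎
  where
  open ≡-Reasoning
  transport : ∀ x → orbitMin? f′ toℕ (g ⟨$⟩ʳ x) ≡ orbitMin? (π ⟨$⟩ʳ_) (toℕ ∘ (g ⟨$⟩ʳ_)) x
  transport x = cong and (Listₚ.map-cong
    (λ k → cong (λ y → ⌊ toℕ (g ⟨$⟩ʳ x) ≤? toℕ y ⌋) (iter-conj (π ⟨$⟩ʳ_) f′ (g ⟨$⟩ʳ_) comm k x))
    (upTo m))
  toℕ∘g-injective : Injective _≡_ _≡_ (toℕ ∘ (g ⟨$⟩ʳ_))
  toℕ∘g-injective eq = trans (sym (inverseˡ g)) (trans (cong (g ⟨$⟩ˡ_) (Finₚ.toℕ-injective eq)) (inverseˡ g))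

Orbits-conj : (g : Permutation′ m) (f f′ : Fin m → Fin m) →
              (∀ x → f′ (g ⟨$⟩ʳ x) ≡ g ⟨$⟩ʳ (f x)) → Bijection (Orbits f) (Orbits f′)
Orbits-conj g f f′ comm = record
  { to        = g ⟨$⟩ʳ_
  ; cong      = forth
  ; bijective = injective , λ y → g ⟨$⟩ˡ y , λ r → subst (EqClosure _ _) (inverseʳ g) (forth r)
  }
  where
  forth : ∀ {x y} → EqClosure (λ i j → j ≡ f i) x y → EqClosure (λ i j → j ≡ f′ i) (g ⟨$⟩ʳ x) (g ⟨$⟩ʳ y)
  forth = EqClosure.gmap (g ⟨$⟩ʳ_) (λ {i} e → trans (cong (g ⟨$⟩ʳ_) e) (sym (comm i)))
  back : ∀ {x y} → EqClosure (λ i j → j ≡ f′ i) x y → EqClosure (λ i j → j ≡ f i) (g ⟨$⟩ˡ x) (g ⟨$⟩ˡ y)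
  back = EqClosure.gmap (g ⟨$⟩ˡ_) (λ {i} {j} e → begin
    g ⟨$⟩ˡ j                          ≡⟨ cong (g ⟨$⟩ˡ_) e ⟩
    g ⟨$⟩ˡ f′ i                       ≡⟨ cong (λ y → g ⟨$⟩ˡ f′ y) (inverseʳ g) ⟨
    g ⟨$⟩ˡ f′ (g ⟨$⟩ʳ (g ⟨$⟩ˡ i))      ≡⟨ cong (g ⟨$⟩ˡ_) (comm _) ⟩
    g ⟨$⟩ˡ (g ⟨$⟩ʳ f (g ⟨$⟩ˡ i))       ≡⟨ inverseˡ g ⟩
    f (g ⟨$⟩ˡ i)                      ∎)
    where open ≡-Reasoning
  injective : ∀ {x y} → EqClosure (λ i j → j ≡ f′ i) (g ⟨$⟩ʳ x) (g ⟨$⟩ʳ y) → EqClosure (λ i j → j ≡ f i) x y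
  injective r = subst₂ (EqClosure _) (inverseˡ g) (inverseˡ g) (back r)

∘-comm-conj : (π τ : Permutation′ m) →
              ∀ x → τ ⟨$⟩ʳ (π ⟨$⟩ʳ (π ⟨$⟩ˡ x)) ≡ π ⟨$⟩ˡ (π ⟨$⟩ʳ (τ ⟨$⟩ʳ x))
∘-comm-conj π τ x = trans (cong (τ ⟨$⟩ʳ_) (inverseʳ π)) (sym (inverseˡ π))

numCycles-∘-comm : (π τ : Permutation′ m) →
                   numCycles (λ x → π ⟨$⟩ʳ (τ ⟨$⟩ʳ x)) ≡ numCycles (λ x → τ ⟨$⟩ʳ (π ⟨$⟩ʳ x))
numCycles-∘-comm π τ = sym (numCycles-conj (τ ∘ₚ π) (Perm.flip π) _ (∘-comm-conj π τ))

Orbits-∘-comm : (π τ : Permutation′ m) →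
                Bijection (Orbits (λ x → π ⟨$⟩ʳ (τ ⟨$⟩ʳ x))) (Orbits (λ x → τ ⟨$⟩ʳ (π ⟨$⟩ʳ x)))
Orbits-∘-comm π τ = Orbits-conj (Perm.flip π) _ _ (∘-comm-conj π τ)

inBlock-∘ : ∀ {n} (s t : Fin 4 → Fin 4) i → inBlock {n} s (inBlock {n} t i) ≡ inBlock {n} (s ∘ t) i
inBlock-∘ {n} s t i =
  cong (λ (k , p) → combine k (s p)) (Finₚ.remQuot-combine {n} {4} (block {n} i) (t (pos {n} i)))

inBlock-involutive : ∀ {n} {s : Fin 4 → Fin 4} → (∀ p → s (s p) ≡ p) →
                     ∀ i → inBlock {n} s (inBlock {n} s i) ≡ i
inBlock-involutive {n} {s} s-inv i = begin
  inBlock {n} s (inBlock {n} s i)      ≡⟨ inBlock-∘ {n} s s i ⟩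
  combine (block {n} i) (s (s (pos {n} i))) ≡⟨ cong (combine (block {n} i)) (s-inv (pos {n} i)) ⟩
  combine (block {n} i) (pos {n} i)    ≡⟨ Finₚ.combine-remQuot {n} 4 i ⟩
  i                                    ∎
  where open ≡-Reasoning

inBlockPerm : ∀ n (s : Fin 4 → Fin 4) → (∀ p → s (s p) ≡ p) → Permutation′ (n * 4)
inBlockPerm n s s-inv =
  Perm.permutation (inBlock {n} s) (inBlock {n} s) (inBlock-involutive {n} {s} s-inv) (inBlock-involutive {n} {s} s-inv)

s₁-involutive : ∀ p → s₁ (s₁ p) ≡ p
s₁-involutive zero                   = refl
s₁-involutive (suc zero)             = refl
s₁-involutive (suc (suc zero))       = refl
s₁-involutive (suc (suc (suc zero))) = refl

s₂-involutive : ∀ p → s₂ (s₂ p) ≡ p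
s₂-involutive zero                   = refl
s₂-involutive (suc zero)             = refl
s₂-involutive (suc (suc zero))       = refl
s₂-involutive (suc (suc (suc zero))) = refl

-- Contracting the colour-3 edges (white x — black x) of G gives the
-- connectivity graph of its map, and conversely.
contract₃ : ∀ {n} → GVertex n → Fin (n * 4)
contract₃ (inj₁ x) = x
contract₃ (inj₂ x) = x

GAdj⇒MAdj : ∀ {n} {σ : Permutation′ (n * 4)} {u v : GVertex n} →
            GAdj {n} σ u v → EqClosure (MAdj {n} σ) (contract₃ {n} u) (contract₃ {n} v)
GAdj⇒MAdj (edge0 x)    = EqClosure.return (atBlack x)
GAdj⇒MAdj (edgeC c1 x) = EqClosure.return (inner1 x)
GAdj⇒MAdj (edgeC c2 x) = EqClosure.return (inner2 x)
GAdj⇒MAdj (edgeC c3 x) = ε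

module _ {n} (σ : Permutation′ (n * 4)) where

  black⇒white : ∀ x → EqClosure (GAdj {n} σ) (inj₂ x) (inj₁ x)
  black⇒white x = EqClosure.symmetric _ (EqClosure.return (edgeC c3 x))

  MAdj⇒GAdj : ∀ {i j} → MAdj {n} σ i j → EqClosure (GAdj {n} σ) (inj₁ i) (inj₁ j)
  MAdj⇒GAdj (inner1 i)  = EqClosure.return (edgeC c1 i) ◅◅ black⇒white _
  MAdj⇒GAdj (inner2 i)  = EqClosure.return (edgeC c2 i) ◅◅ black⇒white _
  MAdj⇒GAdj (atBlack i) = EqClosure.return (edge0 i) ◅◅ black⇒white _

  contract₃⇒self : ∀ u → EqClosure (GAdj {n} σ) (inj₁ (contract₃ {n} u)) u
  contract₃⇒self (inj₁ x) = ε
  contract₃⇒self (inj₂ x) = EqClosure.symmetric _ (black⇒white x)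

Φ : GGraph → MMap
Φ G = record
  { b         = n G
  ; nonempty  = nonempty G
  ; ρ         = σ G
  ; connected = λ i j → EqClosure.gfold (EqClosure.isEquivalence (MAdj {n G} (σ G)))
                          (contract₃ {n G}) (GAdj⇒MAdj {n G}) (connected G (inj₁ i) (inj₁ j))
  }

Φ⁻¹ : MMap → GGraph
Φ⁻¹ M = record
  { n         = b M
  ; nonempty  = nonempty M
  ; σ         = ρ M
  ; connected = λ u v →
      EqClosure.symmetric _ (contract₃⇒self (ρ M) u)
      ◅◅ EqClosure.gfold (EqClosure.isEquivalence (GAdj {b M} (ρ M))) inj₁ (MAdj⇒GAdj (ρ M))
           (connected M (contract₃ {b M} u) (contract₃ {b M} v))
      ◅◅ contract₃⇒self (ρ M) v
  }

Φ-preserves-≅ : ∀ {G G′} → G ≅G G′ → Φ G ≅M Φ G′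
Φ-preserves-≅ φ = record { f = f ; presρ = pres0 ; pres1 = pres1 ; pres2 = pres2 }
  where open _≅G_ φ

Φ-reflects-≅ : ∀ {G G′} → Φ G ≅M Φ G′ → G ≅G G′
Φ-reflects-≅ φ = record { f = f ; pres0 = presρ ; pres1 = pres1 ; pres2 = pres2 }
  where open _≅M_ φ

Φ∘Φ⁻¹≅id : ∀ M → Φ (Φ⁻¹ M) ≅M M
Φ∘Φ⁻¹≅id M = record { f = Perm.id ; presρ = λ _ → refl ; pres1 = λ _ → refl ; pres2 = λ _ → refl }

FG≡FM∘Φ : ∀ G → FG G ≡ FM (Φ G)
FG≡FM∘Φ G = cong₂ (λ k l → k + l + numCycles (σ G ⟨$⟩ʳ_))
  (numCycles-∘-comm (inBlockPerm (n G) s₁ s₁-involutive) (σ G))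
  (numCycles-∘-comm (inBlockPerm (n G) s₂ s₂-involutive) (σ G))

theorem1 : Σ (GGraph → MMap) λ Φ →
    ((∀ {G G′} → G ≅G G′ → Φ G ≅M Φ G′)
  × (∀ {G G′} → Φ G ≅M Φ G′ → G ≅G G′)
  × (∀ M → ∃ λ G → Φ G ≅M M))
  × (∀ G →
      (Bubbles G ⤖ SquareVertices (Φ G))
    × Bijection (FacesG G c1) (FacesMap (Φ G) c1)
    × Bijection (FacesG G c2) (FacesMap (Φ G) c2)
    × Bijection (FacesG G c3) (BlackVertices (Φ G))
    × (n G ≡ b (Φ G))
    × (FG G ≡ FM (Φ G)))
theorem1 = Φ , (Φ-preserves-≅ , Φ-reflects-≅ , λ M → Φ⁻¹ M , Φ∘Φ⁻¹≅id M) , λ G →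
    ⤖-id (Fin (n G))
  , Orbits-∘-comm (inBlockPerm (n G) s₁ s₁-involutive) (σ G)
  , Orbits-∘-comm (inBlockPerm (n G) s₂ s₂-involutive) (σ G)
  , bijection (Orbits (σ G ⟨$⟩ʳ_))
  , refl
  , FG≡FM∘Φ G
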